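{- Let $\mathcal G$ be a strongly regular graph with degree $\delta$ and parameters $\lambda$ and $\mu$. If $\lambda=\nu_2(\mathcal G)$, then for every vertex $u\in V(\mathcal G)$, the number of vertices of every connected component of the neighbourhood graph $\mathcal G_u$ is divisible by $\lambda+1$.
   Context: A strongly regular graph with parameters $(\delta,\lambda,\mu)$ is a connected $\delta$-regular simple graph in which every two adjacent vertices have exactly $\lambda$ common neighbours and every two non-adjacent vertices have exactly $\mu\geq 1$ common neighbours. The neighbourhood graph $\mathcal G_u$ is the induced subgraph on the set of neighbours of $u$. $\nu_1(\mathcal G)\geq\nu_2(\mathcal G)\geq\cdots$ are the eigenvalues of the adjacency matrix of $\mathcal G$ listed with multiplicity, so $\nu_1(\mathcal G)=\delta$ and $\nu_2(\mathcal G)=\tfrac12\big(\lambda-\mu+\sqrt{(\lambda-\mu)^2+4(\delta-\mu)}\big)$. -}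

module Defs where

open import Data.Nat using (ℕ; zero; suc; _≥_)
import Data.Nat as ℕ
open import Data.Integer as ℤ using (ℤ; +_)
open import Data.Fin using (Fin; zero; suc)
open import Data.Bool using (Bool; true; false; T; _∧_; if_then_else_)
open import Data.Product using (_×_)
open import Relation.Binary.PropositionalEquality using (_≡_)
open import Relation.Nullary using (¬_)

record Graph (n : ℕ) : Set where
  field
    adj    : Fin n → Fin n → Bool
    symm   : ∀ u v → adj u v ≡ adj v u
    irrefl : ∀ u → adj u u ≡ false

module _ {n : ℕ} (G : Graph n) where
  open Graph G

  Adj : Fin n → Fin n → Set
  Adj u v = T (adj u v)

  data Reach : Fin n → Fin n → Set where
    here : ∀ {v} → Reach v v
    step : ∀ {v x w} → Adj v x → Reach x w → Reach v w

  Connected : Set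
  Connected = ∀ u v → Reach u v

  -- walks inside the neighbourhood graph G_u (induced subgraph on N(u)):
  -- every vertex after the start is a neighbour of u
  data ReachIn (u : Fin n) : Fin n → Fin n → Set where
    here : ∀ {v} → ReachIn u v v
    step : ∀ {v x w} → Adj v x → Adj u x → ReachIn u x w → ReachIn u v w

count : ∀ {n} → (Fin n → Bool) → ℕ
count {zero}  f = 0
count {suc n} f = (if f zero then 1 else 0) ℕ.+ count (λ i → f (suc i))

module _ {n : ℕ} (G : Graph n) where
  open Graph G

  degree : Fin n → ℕ
  degree u = count (adj u)

  commonNbrs : Fin n → Fin n → ℕ
  commonNbrs u v = count (λ w → adj u w ∧ adj v w)

  record IsSRG (δ lam mu : ℕ) : Set where
    field
      connected : Connected G
      regular   : ∀ u → degree u ≡ δ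
      adjCommon : ∀ u v → Adj G u v → commonNbrs u v ≡ lam
      nonCommon : ∀ u v → ¬ (u ≡ v) → ¬ Adj G u v → commonNbrs u v ≡ mu
      mu≥1      : mu ≥ 1

IsSqrt : ℤ → ℤ → Set
IsSqrt d r = (+ 0 ℤ.≤ r) × (r ℤ.* r ≡ d)

-- x = ν₂ = ½(λ-μ+√((λ-μ)²+4(δ-μ))), i.e. 2x-(λ-μ) = √((λ-μ)²+4(δ-μ))
IsNu2 : (δ lam mu : ℕ) → ℤ → Set
IsNu2 δ lam mu x =
  IsSqrt (((+ lam) ℤ.- (+ mu)) ℤ.* ((+ lam) ℤ.- (+ mu)) ℤ.+ (+ 4) ℤ.* ((+ δ) ℤ.- (+ mu)))
         ((+ 2) ℤ.* x ℤ.- ((+ lam) ℤ.- (+ mu)))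

{-# OPTIONS --safe #-}

-- Let A be the adjacency matrix, S a union of components of the neighbourhood
-- graph G_u, s its indicator vector, c = |S| and α = A s, so that α w counts
-- the neighbours of w in S. Since S is closed in G_u and G_u is λ-regular,
-- α = λ s on N(u). The identity A² = δ I + λ A + μ (J - I - A) then determines
-- the first two moments of α over the set F of vertices far from u (distinct
-- from and not adjacent to u) and, applied to S = N(u), the size of F.
-- When λ = ν₂, i.e. δ = μ (λ + 1), these moments say exactly that
-- Σ_{w ∈ F} ((λ + 1) α w - c)² = 0, so c = (λ + 1) α w as soon as F is
-- nonempty. If F is empty then δ = λ + 1, and c ≤ δ = λ + 1 ≤ c.

module Submission where

open import Defs
open import Data.Bool using (Bool; true; false; T; not; _∧_; _∨_; if_then_else_)
open import Data.Bool.Properties using (T-≡; T-∧)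
open import Data.Empty using (⊥-elim)
open import Data.Fin using (Fin; zero; suc)
open import Data.Fin.Properties using (_≟_; any?)
open import Data.Integer as ℤ using (ℤ; +_)
import Data.Integer.Properties as ℤₚ
import Data.Integer.Tactic.RingSolver as ℤ-Solver
open import Data.List using ([]; _∷_)
open import Data.Nat using (ℕ; zero; suc; _+_; _*_; _≤_; z≤n; ∣_-_∣; NonZero; >-nonZero)
open import Data.Nat.Divisibility using (_∣_; divides)
open import Data.Nat.Properties
  using ( +-comm; +-identityʳ; +-cancelʳ-≡; +-mono-≤; *-comm; *-identityˡ; *-identityʳ
        ; *-distribˡ-+; *-distribʳ-+; *-cancelʳ-≡; *-cancelˡ-≡; m*n≢0; m+n≡0⇒m≡0; m+n≡0⇒n≡0
        ; m*n≡0⇒m≡0∨n≡0; ≤-refl; ≤-trans; ≤-reflexive; ≤-antisym; ≤-total; m≤n+m; m≤n⇒∃[o]m+o≡n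
        ; ∣m-m+n∣≡n; ∣-∣-comm; ∣m-n∣≡0⇒m≡n; +-*-semiring; *-commutativeSemigroup )
open import Data.Nat.Tactic.RingSolver using (solve-∀; solve)
open import Data.Product using (_×_; _,_; proj₁; proj₂)
open import Data.Sum using (inj₁; inj₂; [_,_]′)
open import Data.Vec.Functional using (Vector)
open import Function using (_∘_; id)
open import Function.Bundles using (_⇔_; Equivalence; mk⇔)
open import Relation.Binary.PropositionalEquality
  using (_≡_; _≢_; refl; sym; trans; cong; cong₂; subst; ≢-sym; module ≡-Reasoning)
open import Relation.Nullary using (¬_; does; yes; no; contradiction; T?)
open import Algebra.Properties.Semiring.Sum +-*-semiring
  using (sum; sum-syntax; sum-cong-≗; sum-replicate-zero; ∑-distrib-+; ∑-comm; *-distribˡ-sum; *-distribʳ-sum)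
open import Algebra.Properties.CommutativeSemigroup *-commutativeSemigroup
  using (x∙yz≈y∙xz; xy∙z≈y∙xz; interchange)
open import Algebra.Properties.AbelianGroup ℤₚ.+-0-abelianGroup
  using () renaming (∙-cancelˡ to ℤ-+-cancelˡ)

⟦_⟧ : Bool → ℕ
⟦ b ⟧ = if b then 1 else 0

𝟙 : ∀ {n} → (Fin n → Bool) → Vector ℕ n
𝟙 p i = ⟦ p i ⟧

⟦⟧-idem : ∀ b → ⟦ b ⟧ * ⟦ b ⟧ ≡ ⟦ b ⟧
⟦⟧-idem true  = refl
⟦⟧-idem false = refl

⟦∧⟧ : ∀ a b → ⟦ a ∧ b ⟧ ≡ ⟦ a ⟧ * ⟦ b ⟧
⟦∧⟧ true  b = sym (+-identityʳ ⟦ b ⟧)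
⟦∧⟧ false b = refl

⟦⟧≡1 : ∀ {b} → T b → ⟦ b ⟧ ≡ 1
⟦⟧≡1 {true} _ = refl

⟦⟧≡0 : ∀ {b} → ¬ T b → ⟦ b ⟧ ≡ 0
⟦⟧≡0 {true}  ¬b = ⊥-elim (¬b _)
⟦⟧≡0 {false} _  = refl

⟦⟧-cong : ∀ {a b} → T a ⇔ T b → ⟦ a ⟧ ≡ ⟦ b ⟧
⟦⟧-cong {true}  {true}  _   = refl
⟦⟧-cong {true}  {false} a⇔b = ⊥-elim (Equivalence.to a⇔b _)
⟦⟧-cong {false} {true}  a⇔b = ⊥-elim (Equivalence.from a⇔b _)
⟦⟧-cong {false} {false} _   = refl

⟦⟧-mono : ∀ {a b} → (T a → T b) → ⟦ a ⟧ ≤ ⟦ b ⟧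
⟦⟧-mono {true}  {true}  _   = ≤-refl
⟦⟧-mono {true}  {false} a⇒b = ⊥-elim (a⇒b _)
⟦⟧-mono {false}         _   = z≤n

count≡sum𝟙 : ∀ {n} (p : Fin n → Bool) → count p ≡ sum (𝟙 p)
count≡sum𝟙 {zero}  p = refl
count≡sum𝟙 {suc n} p = cong (_+_ ⟦ p zero ⟧) (count≡sum𝟙 (p ∘ suc))

sum≡0⇒≡0 : ∀ {n} (f : Vector ℕ n) → sum f ≡ 0 → ∀ i → f i ≡ 0
sum≡0⇒≡0 f eq zero    = m+n≡0⇒m≡0 (f zero) eq
sum≡0⇒≡0 f eq (suc i) = sum≡0⇒≡0 (f ∘ suc) (m+n≡0⇒n≡0 (f zero) eq) i

sum-mono-≤ : ∀ {n} {f g : Vector ℕ n} → (∀ i → f i ≤ g i) → sum f ≤ sum g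
sum-mono-≤ {zero}  f≤g = z≤n
sum-mono-≤ {suc n} f≤g = +-mono-≤ (f≤g zero) (sum-mono-≤ (f≤g ∘ suc))

⟨_,_⟩ : ∀ {n} → Vector ℕ n → Vector ℕ n → ℕ
⟨ f , g ⟩ = sum (λ i → f i * g i)

Matrix : ℕ → Set
Matrix n = Fin n → Vector ℕ n

infixr 20 _·_
_·_ : ∀ {n} → Matrix n → Vector ℕ n → Vector ℕ n
(M · f) i = ⟨ M i , f ⟩

I : ∀ {n} → Matrix n
I i = 𝟙 (λ j → does (i ≟ j))

·-identityˡ : ∀ {n} (f : Vector ℕ n) i → (I · f) i ≡ f i
·-identityˡ {suc n} f zero = begin
  1 * f zero + ⟨ I zero ∘ suc , f ∘ suc ⟩  ≡⟨ cong (_+_ (1 * f zero)) (sum-replicate-zero n) ⟩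
  1 * f zero + 0                          ≡⟨ +-identityʳ (1 * f zero) ⟩
  1 * f zero                              ≡⟨ *-identityˡ (f zero) ⟩
  f zero                                  ∎
  where open ≡-Reasoning
·-identityˡ {suc n} f (suc i) = ·-identityˡ (f ∘ suc) i

module _ {n : ℕ} where

  ⟨⟩-comm : (f g : Vector ℕ n) → ⟨ f , g ⟩ ≡ ⟨ g , f ⟩
  ⟨⟩-comm f g = sum-cong-≗ (λ i → *-comm (f i) (g i))

  ⟨⟩-distrib-+ : (f g h : Vector ℕ n) → ⟨ f , (λ i → g i + h i) ⟩ ≡ ⟨ f , g ⟩ + ⟨ f , h ⟩
  ⟨⟩-distrib-+ f g h = trans (sum-cong-≗ (λ i → *-distribˡ-+ (f i) (g i) (h i)))
                             (∑-distrib-+ (λ i → f i * g i) (λ i → f i * h i))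

  ⟨⟩-scale : (f g : Vector ℕ n) (a : ℕ) → ⟨ f , (λ i → a * g i) ⟩ ≡ a * ⟨ f , g ⟩
  ⟨⟩-scale f g a = trans (sum-cong-≗ (λ i → x∙yz≈y∙xz (f i) a (g i)))
                         (sym (*-distribˡ-sum a (λ i → f i * g i)))

  ⟨⟩-constʳ : (f : Vector ℕ n) (a : ℕ) → ⟨ f , (λ _ → a) ⟩ ≡ sum f * a
  ⟨⟩-constʳ f a = sym (*-distribʳ-sum a f)

  ⟨⟩-combination : (f g h k : Vector ℕ n) (a b c : ℕ) →
    ⟨ f , (λ i → a * g i + b * h i + c * k i) ⟩ ≡ a * ⟨ f , g ⟩ + b * ⟨ f , h ⟩ + c * ⟨ f , k ⟩
  ⟨⟩-combination f g h k a b c = begin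
    ⟨ f , (λ i → a * g i + b * h i + c * k i) ⟩
      ≡⟨ ⟨⟩-distrib-+ f (λ i → a * g i + b * h i) (λ i → c * k i) ⟩
    ⟨ f , (λ i → a * g i + b * h i) ⟩ + ⟨ f , (λ i → c * k i) ⟩
      ≡⟨ cong (_+ ⟨ f , (λ i → c * k i) ⟩) (⟨⟩-distrib-+ f (λ i → a * g i) (λ i → b * h i)) ⟩
    ⟨ f , (λ i → a * g i) ⟩ + ⟨ f , (λ i → b * h i) ⟩ + ⟨ f , (λ i → c * k i) ⟩
      ≡⟨ cong₂ _+_ (cong₂ _+_ (⟨⟩-scale f g a) (⟨⟩-scale f h b)) (⟨⟩-scale f k c) ⟩
    a * ⟨ f , g ⟩ + b * ⟨ f , h ⟩ + c * ⟨ f , k ⟩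
      ∎
    where open ≡-Reasoning

  ⟨𝟙,𝟙⟩ : (p : Fin n → Bool) → ⟨ 𝟙 p , 𝟙 p ⟩ ≡ sum (𝟙 p)
  ⟨𝟙,𝟙⟩ p = sum-cong-≗ (λ i → ⟦⟧-idem (p i))

  ⟨𝟙,⟩-cong : (p : Fin n → Bool) {f g : Vector ℕ n} →
              (∀ i → T (p i) → f i ≡ g i) → ⟨ 𝟙 p , f ⟩ ≡ ⟨ 𝟙 p , g ⟩
  ⟨𝟙,⟩-cong p f≡g = sum-cong-≗ (λ i → on (p i) (f≡g i))
    where
    on : ∀ b {x y} → (T b → x ≡ y) → ⟦ b ⟧ * x ≡ ⟦ b ⟧ * y
    on true  x≡y = cong (_+ 0) (x≡y _)
    on false _   = refl

  ·-selfAdjoint : (M : Matrix n) → (∀ i j → M i j ≡ M j i) →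
                  (f g : Vector ℕ n) → ⟨ M · f , g ⟩ ≡ ⟨ f , M · g ⟩
  ·-selfAdjoint M M-sym f g = begin
    ∑[ i < n ] ((∑[ j < n ] (M i j * f j)) * g i)  ≡⟨ sum-cong-≗ (λ i → *-distribʳ-sum (g i) (λ j → M i j * f j)) ⟩
    ∑[ i < n ] ∑[ j < n ] (M i j * f j * g i)      ≡⟨ ∑-comm (λ i j → M i j * f j * g i) ⟩
    ∑[ j < n ] ∑[ i < n ] (M i j * f j * g i)      ≡⟨ sum-cong-≗ (λ j → sum-cong-≗ (rearrange j)) ⟩
    ∑[ j < n ] ∑[ i < n ] (f j * (M j i * g i))    ≡⟨ sum-cong-≗ (λ j → *-distribˡ-sum (f j) (λ i → M j i * g i)) ⟨
    ∑[ j < n ] (f j * ∑[ i < n ] (M j i * g i))    ∎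
    where
    open ≡-Reasoning
    rearrange : ∀ j i → M i j * f j * g i ≡ f j * (M j i * g i)
    rearrange j i rewrite M-sym i j = xy∙z≈y∙xz (M j i) (f j) (g i)

square-expansion-≤ : ∀ {x y} → x ≤ y → x * x + y * y ≡ 2 * (x * y) + ∣ x - y ∣ * ∣ x - y ∣
square-expansion-≤ {x} x≤y with m≤n⇒∃[o]m+o≡n x≤y
... | k , refl rewrite ∣m-m+n∣≡n x k = expand x k
  where
  expand : ∀ x k → x * x + (x + k) * (x + k) ≡ 2 * (x * (x + k)) + k * k
  expand = solve-∀

square-expansion : ∀ x y → x * x + y * y ≡ 2 * (x * y) + ∣ x - y ∣ * ∣ x - y ∣
square-expansion x y with ≤-total x y
... | inj₁ x≤y = square-expansion-≤ x≤y
... | inj₂ y≤x = begin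
  x * x + y * y                          ≡⟨ +-comm (x * x) (y * y) ⟩
  y * y + x * x                          ≡⟨ square-expansion-≤ y≤x ⟩
  2 * (y * x) + ∣ y - x ∣ * ∣ y - x ∣    ≡⟨ cong₂ (λ a d → 2 * a + d * d) (*-comm y x) (∣-∣-comm y x) ⟩
  2 * (x * y) + ∣ x - y ∣ * ∣ x - y ∣    ∎
  where open ≡-Reasoning

module _ {n : ℕ} (t α : Vector ℕ n) (L c : ℕ) where

  variance-identity :
    ⟨ t , (λ w → ∣ L * α w - c ∣ * ∣ L * α w - c ∣) ⟩ + 2 * L * c * ⟨ t , α ⟩
      ≡ L * L * ⟨ t , (λ w → α w * α w) ⟩ + sum t * (c * c)
  variance-identity = begin
    ⟨ t , d² ⟩ + 2 * L * c * ⟨ t , α ⟩                    ≡⟨ cong (_+_ ⟨ t , d² ⟩) (⟨⟩-scale t α (2 * L * c)) ⟨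
    ⟨ t , d² ⟩ + ⟨ t , (λ w → 2 * L * c * α w) ⟩          ≡⟨ ⟨⟩-distrib-+ t d² (λ w → 2 * L * c * α w) ⟨
    ⟨ t , (λ w → d² w + 2 * L * c * α w) ⟩                ≡⟨ sum-cong-≗ (λ w → cong (t w *_) (expand (α w))) ⟩
    ⟨ t , (λ w → L * L * α² w + c * c) ⟩                  ≡⟨ ⟨⟩-distrib-+ t (λ w → L * L * α² w) (λ _ → c * c) ⟩
    ⟨ t , (λ w → L * L * α² w) ⟩ + ⟨ t , (λ _ → c * c) ⟩  ≡⟨ cong₂ _+_ (⟨⟩-scale t α² (L * L)) (⟨⟩-constʳ t (c * c)) ⟩
    L * L * ⟨ t , α² ⟩ + sum t * (c * c)                  ∎
    where
    open ≡-Reasoning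
    d² α² : Vector ℕ n
    d² w = ∣ L * α w - c ∣ * ∣ L * α w - c ∣
    α² w = α w * α w
    expand : ∀ a → ∣ L * a - c ∣ * ∣ L * a - c ∣ + 2 * L * c * a ≡ L * L * (a * a) + c * c
    expand a = begin
      ∣ L * a - c ∣ * ∣ L * a - c ∣ + 2 * L * c * a    ≡⟨ +-comm _ (2 * L * c * a) ⟩
      2 * L * c * a + ∣ L * a - c ∣ * ∣ L * a - c ∣    ≡⟨ cong (_+ ∣ L * a - c ∣ * ∣ L * a - c ∣) (solve (L ∷ c ∷ a ∷ [])) ⟩
      2 * (L * a * c) + ∣ L * a - c ∣ * ∣ L * a - c ∣  ≡⟨ square-expansion (L * a) c ⟨
      L * a * (L * a) + c * c                          ≡⟨ cong (_+ c * c) (solve (L ∷ a ∷ [])) ⟩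
      L * L * (a * a) + c * c                          ∎

  zero-variance⇒L*α≡c :
    L * L * ⟨ t , (λ w → α w * α w) ⟩ + sum t * (c * c) ≡ 2 * L * c * ⟨ t , α ⟩ →
    ∀ w → t w ≢ 0 → L * α w ≡ c
  zero-variance⇒L*α≡c zero-variance w tw≢0
    with m*n≡0⇒m≡0∨n≡0 (t w) (sum≡0⇒≡0 _ (+-cancelʳ-≡ _ _ 0 (trans variance-identity zero-variance)) w)
  ... | inj₁ tw≡0 = contradiction tw≡0 tw≢0
  ... | inj₂ d²≡0 = ∣m-n∣≡0⇒m≡n ([ id , id ]′ (m*n≡0⇒m≡0∨n≡0 _ d²≡0))

moments⇒zero-variance : ∀ {δ μ L c A₁ A₂ N P} .{{_ : NonZero μ}} → δ ≡ μ * L →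
  A₁ + c * L ≡ c * δ → N * μ + δ * L ≡ δ * δ → A₂ + c * c ≡ c * δ + μ * P → P + c * L ≡ c * c →
  L * L * A₂ + N * (c * c) ≡ 2 * L * c * A₁
moments⇒zero-variance {μ = μ} {L} {c} {A₁} {A₂} {N} {P} refl hA₁ hN hA₂ hP =
  +-cancelʳ-≡ (2 * (L * L * (c * c))) _ _ (begin
    L * L * A₂ + N * (c * c) + 2 * (L * L * (c * c))  ≡⟨ solve (L ∷ c ∷ A₂ ∷ N ∷ []) ⟩
    L * L * (A₂ + c * c) + (N + L * L) * (c * c)      ≡⟨ cong₂ (λ a b → L * L * a + b * (c * c)) A₂+c² N+L² ⟩
    L * L * (μ * (c * c)) + μ * (L * L) * (c * c)     ≡⟨ solve (μ ∷ L ∷ c ∷ []) ⟩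
    2 * L * c * (μ * (c * L))                         ≡⟨ cong (2 * L * c *_) A₁+cL ⟨
    2 * L * c * (A₁ + c * L)                          ≡⟨ solve (L ∷ c ∷ A₁ ∷ []) ⟩
    2 * L * c * A₁ + 2 * (L * L * (c * c))            ∎)
  where
  open ≡-Reasoning
  A₁+cL : A₁ + c * L ≡ μ * (c * L)
  A₁+cL = trans hA₁ (solve (μ ∷ L ∷ c ∷ []))
  N+L² : N + L * L ≡ μ * (L * L)
  N+L² = *-cancelʳ-≡ _ _ μ (begin
    (N + L * L) * μ    ≡⟨ solve (μ ∷ L ∷ N ∷ []) ⟩
    N * μ + μ * L * L  ≡⟨ hN ⟩
    μ * L * (μ * L)    ≡⟨ solve (μ ∷ L ∷ []) ⟩
    μ * (L * L) * μ    ∎)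
  A₂+c² : A₂ + c * c ≡ μ * (c * c)
  A₂+c² = +-cancelʳ-≡ (μ * (c * L)) _ _ (begin
    A₂ + c * c + μ * (c * L)           ≡⟨ cong (_+ μ * (c * L)) hA₂ ⟩
    c * (μ * L) + μ * P + μ * (c * L)  ≡⟨ solve (μ ∷ L ∷ c ∷ P ∷ []) ⟩
    c * (μ * L) + μ * (P + c * L)      ≡⟨ cong (λ x → c * (μ * L) + μ * x) hP ⟩
    c * (μ * L) + μ * (c * c)          ≡⟨ solve (μ ∷ L ∷ c ∷ []) ⟩
    μ * (c * c) + μ * (c * L)          ∎)

-- (2λ - (λ - μ))² = (λ - μ)² + 4 λ μ, so the defining equation of ν₂ = λ says λ μ = δ - μ.
ν₂≡λ⇒δ≡μ[λ+1] : ∀ {δ lam mu} → IsNu2 δ lam mu (+ lam) → δ ≡ mu * suc lam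
ν₂≡λ⇒δ≡μ[λ+1] {δ} {lam} {mu} (_ , root²) = ℤₚ.+-injective (begin
  + δ                ≡⟨ split (+ δ) m ⟩
  + δ ℤ.- m ℤ.+ m    ≡⟨ cong (ℤ._+ m) λμ≡δ-μ ⟨
  l ℤ.* m ℤ.+ m      ≡⟨ factor l m ⟩
  m ℤ.* (+ 1 ℤ.+ l)  ≡⟨ cong (m ℤ.*_) (ℤₚ.pos-+ 1 lam) ⟨
  m ℤ.* + suc lam    ≡⟨ ℤₚ.pos-* mu (suc lam) ⟨
  + (mu * suc lam)   ∎)
  where
  open ≡-Reasoning
  l m : ℤ
  l = + lam
  m = + mu
  expand : ∀ l m → (+ 2 ℤ.* l ℤ.- (l ℤ.- m)) ℤ.* (+ 2 ℤ.* l ℤ.- (l ℤ.- m))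
                   ≡ (l ℤ.- m) ℤ.* (l ℤ.- m) ℤ.+ + 4 ℤ.* (l ℤ.* m)
  expand = ℤ-Solver.solve-∀
  split : ∀ d m → d ≡ d ℤ.- m ℤ.+ m
  split = ℤ-Solver.solve-∀
  factor : ∀ l m → l ℤ.* m ℤ.+ m ≡ m ℤ.* (+ 1 ℤ.+ l)
  factor = ℤ-Solver.solve-∀
  λμ≡δ-μ : l ℤ.* m ≡ + δ ℤ.- m
  λμ≡δ-μ = ℤₚ.*-cancelˡ-≡ (+ 4) _ _
    (ℤ-+-cancelˡ ((l ℤ.- m) ℤ.* (l ℤ.- m)) _ _ (trans (sym (expand l m)) root²))

module Adjacency {n : ℕ} (G : Graph n) where
  open Graph G

  A : Matrix n
  A x = 𝟙 (adj x)

  adjᶜ : Fin n → Fin n → Bool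
  adjᶜ x y = not (does (x ≟ y) ∨ adj x y)

  Ā : Matrix n
  Ā x = 𝟙 (adjᶜ x)

  Adj-sym : ∀ {x y} → Adj G x y → Adj G y x
  Adj-sym {x} {y} = subst T (symm x y)

  A-sym : ∀ x y → A x y ≡ A y x
  A-sym x y = cong ⟦_⟧ (symm x y)

  adjᶜ⇒≢×¬Adj : ∀ {x y} → T (adjᶜ x y) → x ≢ y × ¬ (Adj G x y)
  adjᶜ⇒≢×¬Adj {x} {y} _ with x ≟ y | adj x y
  ... | no x≢y | false = x≢y , id

  I+A+Ā≡1 : ∀ x y → I x y + A x y + Ā x y ≡ 1
  I+A+Ā≡1 x y with x ≟ y
  ... | yes refl rewrite irrefl x = refl
  ... | no _ with adj x y
  ...   | true  = refl
  ...   | false = refl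

  sum-split : ∀ (f : Vector ℕ n) x → sum f ≡ f x + (A · f) x + (Ā · f) x
  sum-split f x = begin
    sum f                                                  ≡⟨ sum-cong-≗ partition ⟩
    sum (λ y → I x y * f y + A x y * f y + Ā x y * f y)    ≡⟨ ∑-distrib-+ (λ y → I x y * f y + A x y * f y) (λ y → Ā x y * f y) ⟩
    sum (λ y → I x y * f y + A x y * f y) + (Ā · f) x      ≡⟨ cong (_+ (Ā · f) x) (∑-distrib-+ (λ y → I x y * f y) (λ y → A x y * f y)) ⟩
    (I · f) x + (A · f) x + (Ā · f) x                      ≡⟨ cong (λ z → z + (A · f) x + (Ā · f) x) (·-identityˡ f x) ⟩
    f x + (A · f) x + (Ā · f) x                            ∎
    where
    open ≡-Reasoning
    partition : ∀ y → f y ≡ I x y * f y + A x y * f y + Ā x y * f y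
    partition y = begin
      f y                                      ≡⟨ *-identityˡ (f y) ⟨
      1 * f y                                  ≡⟨ cong (_* f y) (I+A+Ā≡1 x y) ⟨
      (I x y + A x y + Ā x y) * f y            ≡⟨ *-distribʳ-+ (f y) (I x y + A x y) (Ā x y) ⟩
      (I x y + A x y) * f y + Ā x y * f y      ≡⟨ cong (_+ Ā x y * f y) (*-distribʳ-+ (f y) (I x y) (A x y)) ⟩
      I x y * f y + A x y * f y + Ā x y * f y  ∎

  ⟨A,A⟩≡commonNbrs : ∀ x y → ⟨ A x , A y ⟩ ≡ commonNbrs G x y
  ⟨A,A⟩≡commonNbrs x y = sym (trans (count≡sum𝟙 (λ w → adj x w ∧ adj y w))
                                    (sum-cong-≗ (λ w → ⟦∧⟧ (adj x w) (adj y w))))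

  sum-A≡degree : ∀ x → sum (A x) ≡ degree G x
  sum-A≡degree x = sym (count≡sum𝟙 (adj x))

  record IsUnionOfNbhdComponents (u : Fin n) (S : Fin n → Bool) : Set where
    field
      ⊆nbhd  : ∀ {x} → T (S x) → Adj G u x
      closed : ∀ {x y} → T (S x) → Adj G x y → Adj G u y → T (S y)

  nbhd-isUnionOfNbhdComponents : ∀ u → IsUnionOfNbhdComponents u (adj u)
  nbhd-isUnionOfNbhdComponents u = record { ⊆nbhd = id ; closed = λ _ _ uy → uy }

  ReachIn-snoc : ∀ {u v x y} → ReachIn G u v x → Adj G x y → Adj G u y → ReachIn G u v y
  ReachIn-snoc here         xy uy = step xy uy here
  ReachIn-snoc (step p q r) xy uy = step p q (ReachIn-snoc r xy uy)

  component-isUnionOfNbhdComponents : ∀ {u v} {S : Fin n → Bool} →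
    (∀ w → T (S w) ⇔ (Adj G u w × ReachIn G u v w)) → IsUnionOfNbhdComponents u S
  component-isUnionOfNbhdComponents S⇔ = record
    { ⊆nbhd  = λ {x} x∈S → proj₁ (Equivalence.to (S⇔ x) x∈S)
    ; closed = λ {x} {y} x∈S xy uy →
        Equivalence.from (S⇔ y) (uy , ReachIn-snoc (proj₂ (Equivalence.to (S⇔ x) x∈S)) xy uy)
    }

module StronglyRegular {n : ℕ} {G : Graph n} {δ lam mu : ℕ} (srg : IsSRG G δ lam mu) where
  open Graph G
  open IsSRG srg
  open Adjacency G

  L : ℕ
  L = suc lam

  A²-entry : ∀ x y → ⟨ A x , A y ⟩ ≡ δ * I x y + lam * A x y + mu * Ā x y
  A²-entry x y with x ≟ y
  ... | yes refl rewrite irrefl x = begin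
    ⟨ A x , A x ⟩  ≡⟨ ⟨𝟙,𝟙⟩ (adj x) ⟩
    sum (A x)      ≡⟨ sum-A≡degree x ⟩
    degree G x     ≡⟨ regular x ⟩
    δ              ≡⟨ solve (δ ∷ lam ∷ mu ∷ []) ⟩
    δ * 1 + lam * 0 + mu * 0 ∎
    where open ≡-Reasoning
  ... | no x≢y with adj x y in xy
  ...   | true = begin
    ⟨ A x , A y ⟩     ≡⟨ ⟨A,A⟩≡commonNbrs x y ⟩
    commonNbrs G x y  ≡⟨ adjCommon x y (Equivalence.from T-≡ xy) ⟩
    lam               ≡⟨ solve (δ ∷ lam ∷ mu ∷ []) ⟩
    δ * 0 + lam * 1 + mu * 0 ∎
    where open ≡-Reasoning
  ...   | false = begin
    ⟨ A x , A y ⟩     ≡⟨ ⟨A,A⟩≡commonNbrs x y ⟩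
    commonNbrs G x y  ≡⟨ nonCommon x y x≢y (subst T xy) ⟩
    mu                ≡⟨ solve (δ ∷ lam ∷ mu ∷ []) ⟩
    δ * 0 + lam * 0 + mu * 1 ∎
    where open ≡-Reasoning

  A²-identity : ∀ f x → (A · A · f) x ≡ δ * f x + lam * (A · f) x + mu * (Ā · f) x
  A²-identity f x = begin
    ⟨ A x , A · f ⟩                                        ≡⟨ ·-selfAdjoint A A-sym (A x) f ⟨
    ⟨ A · A x , f ⟩                                        ≡⟨ ⟨⟩-comm (A · A x) f ⟩
    ⟨ f , A · A x ⟩                                        ≡⟨ sum-cong-≗ (λ y → cong (f y *_) (A²-entryᵀ y)) ⟩
    ⟨ f , (λ y → δ * I x y + lam * A x y + mu * Ā x y) ⟩  ≡⟨ ⟨⟩-combination f (I x) (A x) (Ā x) δ lam mu ⟩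
    δ * ⟨ f , I x ⟩ + lam * ⟨ f , A x ⟩ + mu * ⟨ f , Ā x ⟩
      ≡⟨ cong₂ (λ a b → δ * a + lam * b + mu * ⟨ f , Ā x ⟩) (trans (⟨⟩-comm f (I x)) (·-identityˡ f x)) (⟨⟩-comm f (A x)) ⟩
    δ * f x + lam * ⟨ A x , f ⟩ + mu * ⟨ f , Ā x ⟩         ≡⟨ cong (λ a → δ * f x + lam * ⟨ A x , f ⟩ + mu * a) (⟨⟩-comm f (Ā x)) ⟩
    δ * f x + lam * ⟨ A x , f ⟩ + mu * ⟨ Ā x , f ⟩         ∎
    where
    open ≡-Reasoning
    A²-entryᵀ : ∀ y → ⟨ A y , A x ⟩ ≡ δ * I x y + lam * A x y + mu * Ā x y
    A²-entryᵀ y = trans (⟨⟩-comm (A y) (A x)) (A²-entry x y)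

  A·𝟏≡δ : ∀ x → (A · (λ _ → 1)) x ≡ δ
  A·𝟏≡δ x = trans (⟨⟩-constʳ (A x) 1) (trans (*-identityʳ _) (trans (sum-A≡degree x) (regular x)))

  module NbhdUnion {u : Fin n} {S : Fin n → Bool} (S-union : IsUnionOfNbhdComponents u S) where
    open IsUnionOfNbhdComponents S-union

    s : Vector ℕ n
    s = 𝟙 S

    c : ℕ
    c = sum s

    α α² : Vector ℕ n
    α = A · s
    α² w = α w * α w

    member-along-edge : ∀ {w x} → Adj G u w → Adj G w x → s x ≡ s w * A u x
    member-along-edge {w} {x} uw wx = trans (⟦⟧-cong (mk⇔ to from)) (⟦∧⟧ (S w) (adj u x))
      where
      to : T (S x) → T (S w ∧ adj u x)
      to x∈S = Equivalence.from T-∧ (closed x∈S (Adj-sym wx) uw , ⊆nbhd x∈S)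
      from : T (S w ∧ adj u x) → T (S x)
      from w∈S∧ux = closed (proj₁ (Equivalence.to T-∧ w∈S∧ux)) wx (proj₂ (Equivalence.to T-∧ w∈S∧ux))

    α-on-nbhd : ∀ {w} → Adj G u w → α w ≡ lam * s w
    α-on-nbhd {w} uw = begin
      ⟨ A w , s ⟩                    ≡⟨ ⟨𝟙,⟩-cong (adj w) (λ x → member-along-edge uw) ⟩
      ⟨ A w , (λ x → s w * A u x) ⟩  ≡⟨ ⟨⟩-scale (A w) (A u) (s w) ⟩
      s w * ⟨ A w , A u ⟩            ≡⟨ cong (s w *_) (⟨A,A⟩≡commonNbrs w u) ⟩
      s w * commonNbrs G w u         ≡⟨ cong (s w *_) (adjCommon w u (Adj-sym uw)) ⟩
      s w * lam                      ≡⟨ *-comm (s w) lam ⟩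
      lam * s w                      ∎
      where open ≡-Reasoning

    α-at-u : α u ≡ c
    α-at-u = begin
      ⟨ A u , s ⟩        ≡⟨ ⟨⟩-comm (A u) s ⟩
      ⟨ s , A u ⟩        ≡⟨ ⟨𝟙,⟩-cong S (λ x x∈S → ⟦⟧≡1 (⊆nbhd x∈S)) ⟩
      ⟨ s , (λ _ → 1) ⟩  ≡⟨ ⟨⟩-constʳ s 1 ⟩
      c * 1              ≡⟨ *-identityʳ c ⟩
      c                  ∎
      where open ≡-Reasoning

    ⟨s,α⟩ : ⟨ s , α ⟩ ≡ lam * c
    ⟨s,α⟩ = begin
      ⟨ s , α ⟩                  ≡⟨ ⟨𝟙,⟩-cong S (λ x → α-on-nbhd ∘ ⊆nbhd) ⟩
      ⟨ s , (λ x → lam * s x) ⟩  ≡⟨ ⟨⟩-scale s s lam ⟩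
      lam * ⟨ s , s ⟩            ≡⟨ cong (lam *_) (⟨𝟙,𝟙⟩ S) ⟩
      lam * c                    ∎
      where open ≡-Reasoning

    A·α-at-u : (A · α) u ≡ lam * c
    A·α-at-u = begin
      ⟨ A u , α ⟩                  ≡⟨ ⟨𝟙,⟩-cong (adj u) (λ w → α-on-nbhd) ⟩
      ⟨ A u , (λ w → lam * s w) ⟩  ≡⟨ ⟨⟩-scale (A u) s lam ⟩
      lam * α u                    ≡⟨ cong (lam *_) α-at-u ⟩
      lam * c                      ∎
      where open ≡-Reasoning

    A·α²-at-u : (A · α²) u ≡ lam * lam * c
    A·α²-at-u = begin
      ⟨ A u , α² ⟩                       ≡⟨ ⟨𝟙,⟩-cong (adj u) (λ w → square ∘ α-on-nbhd) ⟩
      ⟨ A u , (λ w → lam * lam * s w) ⟩  ≡⟨ ⟨⟩-scale (A u) s (lam * lam) ⟩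
      lam * lam * α u                    ≡⟨ cong (lam * lam *_) α-at-u ⟩
      lam * lam * c                      ∎
      where
      open ≡-Reasoning
      square : ∀ {w} → α w ≡ lam * s w → α w * α w ≡ lam * lam * s w
      square {w} αw = begin
        α w * α w                ≡⟨ cong₂ _*_ αw αw ⟩
        lam * s w * (lam * s w)  ≡⟨ interchange lam (s w) lam (s w) ⟩
        lam * lam * (s w * s w)  ≡⟨ cong (lam * lam *_) (⟦⟧-idem (S w)) ⟩
        lam * lam * s w          ∎

    split-at-member : ∀ {x} → T (S x) → (Ā · s) x + L ≡ c
    split-at-member {x} x∈S = begin
      (Ā · s) x + L          ≡⟨ +-comm ((Ā · s) x) L ⟩
      1 + lam + (Ā · s) x    ≡⟨ cong₂ (λ a b → a + b + (Ā · s) x) sx≡1 αx≡lam ⟨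
      s x + α x + (Ā · s) x  ≡⟨ sum-split s x ⟨
      c                      ∎
      where
      open ≡-Reasoning
      sx≡1 : s x ≡ 1
      sx≡1 = ⟦⟧≡1 x∈S
      αx≡lam : α x ≡ lam
      αx≡lam = trans (α-on-nbhd (⊆nbhd x∈S)) (trans (cong (lam *_) sx≡1) (*-identityʳ lam))

    ⟨s,Ā·s⟩+cL≡c² : ⟨ s , Ā · s ⟩ + c * L ≡ c * c
    ⟨s,Ā·s⟩+cL≡c² = begin
      ⟨ s , Ā · s ⟩ + c * L            ≡⟨ cong (_+_ ⟨ s , Ā · s ⟩) (⟨⟩-constʳ s L) ⟨
      ⟨ s , Ā · s ⟩ + ⟨ s , (λ _ → L) ⟩  ≡⟨ ⟨⟩-distrib-+ s (Ā · s) (λ _ → L) ⟨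
      ⟨ s , (λ x → (Ā · s) x + L) ⟩    ≡⟨ ⟨𝟙,⟩-cong S (λ x → split-at-member) ⟩
      ⟨ s , (λ _ → c) ⟩                ≡⟨ ⟨⟩-constʳ s c ⟩
      c * c                            ∎
      where open ≡-Reasoning

    sum-α : sum α ≡ c * δ
    sum-α = begin
      sum α                  ≡⟨ trans (⟨⟩-constʳ α 1) (*-identityʳ (sum α)) ⟨
      ⟨ α , (λ _ → 1) ⟩      ≡⟨ ·-selfAdjoint A A-sym s (λ _ → 1) ⟩
      ⟨ s , A · (λ _ → 1) ⟩  ≡⟨ sum-cong-≗ (λ x → cong (s x *_) (A·𝟏≡δ x)) ⟩
      ⟨ s , (λ _ → δ) ⟩      ≡⟨ ⟨⟩-constʳ s δ ⟩
      c * δ                  ∎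
      where open ≡-Reasoning

    first-moment : ⟨ Ā u , α ⟩ + c * L ≡ c * δ
    first-moment = begin
      ⟨ Ā u , α ⟩ + c * L          ≡⟨ shuffle ⟨ Ā u , α ⟩ c lam ⟩
      c + lam * c + ⟨ Ā u , α ⟩    ≡⟨ cong₂ (λ a b → a + b + ⟨ Ā u , α ⟩) α-at-u A·α-at-u ⟨
      α u + (A · α) u + (Ā · α) u  ≡⟨ sum-split α u ⟨
      sum α                        ≡⟨ sum-α ⟩
      c * δ                        ∎
      where
      open ≡-Reasoning
      shuffle : ∀ a c l → a + c * suc l ≡ c + l * c + a
      shuffle = solve-∀

    second-moment : ⟨ Ā u , α² ⟩ + c * c ≡ c * δ + mu * ⟨ s , Ā · s ⟩
    second-moment = +-cancelʳ-≡ (lam * lam * c) _ _ (begin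
      ⟨ Ā u , α² ⟩ + c * c + lam * lam * c          ≡⟨ shuffle ⟨ Ā u , α² ⟩ (c * c) (lam * lam * c) ⟩
      c * c + lam * lam * c + ⟨ Ā u , α² ⟩          ≡⟨ cong₂ (λ a b → a + b + ⟨ Ā u , α² ⟩) (cong₂ _*_ α-at-u α-at-u) A·α²-at-u ⟨
      α u * α u + (A · α²) u + (Ā · α²) u           ≡⟨ sum-split α² u ⟨
      ⟨ A · s , A · s ⟩                             ≡⟨ ·-selfAdjoint A A-sym s α ⟩
      ⟨ s , A · A · s ⟩                             ≡⟨ sum-cong-≗ (λ x → cong (s x *_) (A²-identity s x)) ⟩
      ⟨ s , (λ x → δ * s x + lam * α x + mu * (Ā · s) x) ⟩
                                                    ≡⟨ ⟨⟩-combination s s α (Ā · s) δ lam mu ⟩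
      δ * ⟨ s , s ⟩ + lam * ⟨ s , α ⟩ + mu * ⟨ s , Ā · s ⟩
                                                    ≡⟨ cong₂ (λ a b → δ * a + lam * b + mu * ⟨ s , Ā · s ⟩) (⟨𝟙,𝟙⟩ S) ⟨s,α⟩ ⟩
      δ * c + lam * (lam * c) + mu * ⟨ s , Ā · s ⟩  ≡⟨ regroup δ c lam (mu * ⟨ s , Ā · s ⟩) ⟩
      c * δ + mu * ⟨ s , Ā · s ⟩ + lam * lam * c    ∎)
      where
      open ≡-Reasoning
      shuffle : ∀ a b d → a + b + d ≡ b + d + a
      shuffle = solve-∀
      regroup : ∀ δ c l p → δ * c + l * (l * c) + p ≡ c * δ + p + l * l * c
      regroup = solve-∀

    c≤δ : c ≤ δ
    c≤δ = ≤-trans (sum-mono-≤ {f = s} {g = A u} (λ x → ⟦⟧-mono ⊆nbhd))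
                  (≤-reflexive (trans (sum-A≡degree u) (regular u)))

    L≤c : ∀ {x} → T (S x) → L ≤ c
    L≤c x∈S = ≤-trans (m≤n+m L _) (≤-reflexive (split-at-member x∈S))

  far-count : ∀ u → sum (Ā u) * mu + δ * L ≡ δ * δ
  far-count u = begin
    sum (Ā u) * mu + δ * L          ≡⟨ cong₂ (λ a b → a + b * L) (⟨⟩-constʳ (Ā u) mu) |N|≡δ ⟨
    ⟨ Ā u , (λ _ → mu) ⟩ + N.c * L  ≡⟨ cong (_+ N.c * L) (⟨𝟙,⟩-cong (adjᶜ u) (λ w → α-far)) ⟨
    ⟨ Ā u , N.α ⟩ + N.c * L         ≡⟨ N.first-moment ⟩
    N.c * δ                         ≡⟨ cong (_* δ) |N|≡δ ⟩
    δ * δ                           ∎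
    where
    open ≡-Reasoning
    module N = NbhdUnion (nbhd-isUnionOfNbhdComponents u)
    |N|≡δ : N.c ≡ δ
    |N|≡δ = trans (sum-A≡degree u) (regular u)
    α-far : ∀ {w} → T (adjᶜ u w) → N.α w ≡ mu
    α-far {w} uw = trans (⟨A,A⟩≡commonNbrs w u)
      (nonCommon w u (≢-sym (proj₁ (adjᶜ⇒≢×¬Adj uw))) (proj₂ (adjᶜ⇒≢×¬Adj uw) ∘ Adj-sym))

  module Divisibility (δ≡μL : δ ≡ mu * L)
    {u : Fin n} {S : Fin n → Bool} (S-union : IsUnionOfNbhdComponents u S) where
    open NbhdUnion S-union public

    instance
      μ≢0 : NonZero mu
      μ≢0 = >-nonZero mu≥1

    far⇒L*α≡c : ∀ {w} → T (adjᶜ u w) → L * α w ≡ c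
    far⇒L*α≡c {w} uw = zero-variance⇒L*α≡c (Ā u) α L c zero-variance w Āuw≢0
      where
      zero-variance : L * L * ⟨ Ā u , α² ⟩ + sum (Ā u) * (c * c) ≡ 2 * L * c * ⟨ Ā u , α ⟩
      zero-variance = moments⇒zero-variance {c = c} {N = sum (Ā u)} {P = ⟨ s , Ā · s ⟩}
        δ≡μL first-moment (far-count u) second-moment ⟨s,Ā·s⟩+cL≡c²
      Āuw≢0 : Ā u w ≢ 0
      Āuw≢0 = subst (_≢ 0) (sym (⟦⟧≡1 uw)) (λ ())

    no-far⇒c≡L : (∀ w → ¬ T (adjᶜ u w)) → ∀ {x} → T (S x) → c ≡ L
    no-far⇒c≡L no-far x∈S = ≤-antisym (≤-trans c≤δ (≤-reflexive (sym L≡δ))) (L≤c x∈S)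
      where
      instance
        δ≢0 : NonZero δ
        δ≢0 = subst NonZero (sym δ≡μL) (m*n≢0 mu L)
      no-far-vertices : sum (Ā u) ≡ 0
      no-far-vertices = trans (sum-cong-≗ (λ w → ⟦⟧≡0 (no-far w))) (sum-replicate-zero n)
      L≡δ : L ≡ δ
      L≡δ = *-cancelˡ-≡ L δ δ (trans (cong (λ k → k * mu + δ * L) (sym no-far-vertices)) (far-count u))

mainTheorem6 : ∀ {n} (G : Graph n) (δ lam mu : ℕ) → IsSRG G δ lam mu
    → IsNu2 δ lam mu (+ lam)
    → ∀ (u v : Fin n) → Adj G u v
    → (S : Fin n → Bool)
    → (∀ w → T (S w) ⇔ (Adj G u w × ReachIn G u v w))
    → suc lam ∣ count S
mainTheorem6 G δ lam mu srg ν₂≡λ u v uv S S⇔ = subst (suc lam ∣_) (sym (count≡sum𝟙 S)) L∣c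
  where
  open Adjacency G
  open StronglyRegular srg
  open Divisibility (ν₂≡λ⇒δ≡μ[λ+1] {δ} {lam} {mu} ν₂≡λ) (component-isUnionOfNbhdComponents S⇔)
  L∣c : L ∣ c
  L∣c with any? (λ w → T? (adjᶜ u w))
  ... | yes (w , uw) = divides (α w) (trans (sym (far⇒L*α≡c uw)) (*-comm L (α w)))
  ... | no ∄far = divides 1 (trans (no-far⇒c≡L (λ w uw → ∄far (w , uw)) v∈S) (sym (*-identityˡ L)))
    where
    v∈S : T (S v)
    v∈S = Equivalence.from (S⇔ v) (uv , here)
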